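{- Let $d, k \ge 0$ be integers. Then: (1) $f(k,d) \ge \frac{(k+1)(d+2t)}{(d+k+t+1)(d+t)} \ge \frac{k+1}{d+k+1}$, where $t$ is the integer with $1 \le t \le k+1$ and $d \equiv k+1-t \pmod{k+1}$. (2) If $k \ge d$, then $f(k,d) \ge \frac{2k+2-d}{2k+2}$. If $k \ge d = 1$, this bound is realized by the graph $K_{1,k+1} \cup kK_1$, and thus $f(k,1) = \frac{2k+1}{2k+2}$. (3) For every finite simple graph $G$ on $n$ vertices, $\alpha_k(G) \ge \frac{k+1}{\lceil d(G)\rceil + k + 1}\, n$.
   Context: For an integer $k \ge 0$, a $k$-independent set of a graph $G=(V,E)$ is a set $S \subseteq V$ such that the subgraph induced by $S$ has maximum degree at most $k$; $\alpha_k(G)$ is the maximum cardinality of a $k$-independent set of $G$. For a graph $G$, $n(G)$ is its number of vertices and $d(G) = \frac{1}{n(G)}\sum_v \deg(v)$ its average degree. For integers $d,k \ge 0$, $f(k,d) = \inf\left\{ \frac{\alpha_k(G)}{n(G)} : G \text{ is a finite simple graph with } d(G) \le d\right\}$. $K_{1,k+1}$ is the star with $k+1$ leaves, $kK_1$ is the edgeless graph on $k$ vertices, and $\cup$ denotes disjoint union. -}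

module Defs where

open import Data.Bool using (Bool; true; false; _∧_; _∨_; if_then_else_; T)
open import Data.Bool.Properties using (∨-comm)
open import Data.Nat using (ℕ; zero; suc; _+_; _*_; _∸_; _≤_; _≤?_; _≡ᵇ_; _≤ᵇ_; _⊔_; NonZero)
open import Data.Nat.DivMod using (_/_)
open import Data.Fin using (Fin; toℕ)
open import Data.Fin.Subset using (Subset; _∈_; ∣_∣)
open import Data.Fin.Subset.Properties using (_∈?_)
open import Data.Fin.Properties using (all?)
open import Data.List using (List; []; _∷_; _++_; map; allFin; filter; foldr)
open import Data.Nat.ListAction using (sum)
import Data.Vec as V
open V using (lookup)
open import Relation.Nullary using (Dec)
open import Relation.Nullary.Decidable using (_→-dec_)
open import Relation.Binary.PropositionalEquality using (_≡_; refl)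

record Graph (n : ℕ) : Set where
  field
    adj    : Fin n → Fin n → Bool
    sym    : ∀ u v → adj u v ≡ adj v u
    irrefl : ∀ v → adj v v ≡ false
open Graph public

𝟙 : Bool → ℕ
𝟙 b = if b then 1 else 0

deg : ∀ {n} → Graph n → Fin n → ℕ
deg {n} G v = sum (map (λ u → 𝟙 (adj G v u)) (allFin n))

-- sum of all degrees; the average degree d(G) is degSum G / n
degSum : ∀ {n} → Graph n → ℕ
degSum {n} G = sum (map (deg G) (allFin n))

AvgDeg≤ : ∀ {n} → Graph n → ℕ → Set
AvgDeg≤ {n} G d = degSum G ≤ d * n

⌈_/_⌉ : ℕ → (n : ℕ) → .{{NonZero n}} → ℕ
⌈ a / n ⌉ = (a + (n ∸ 1)) / n

⌈avgDeg⌉ : ∀ {n} .{{_ : NonZero n}} → Graph n → ℕ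
⌈avgDeg⌉ {n} G = ⌈ degSum G / n ⌉

degIn : ∀ {n} → Graph n → Subset n → Fin n → ℕ
degIn {n} G S v = sum (map (λ u → 𝟙 (adj G v u ∧ lookup S u)) (allFin n))

KIndep : ∀ {n} → ℕ → Graph n → Subset n → Set
KIndep k G S = ∀ v → v ∈ S → degIn G S v ≤ k

KIndep? : ∀ {n} k (G : Graph n) (S : Subset n) → Dec (KIndep k G S)
KIndep? k G S = all? (λ v → (v ∈? S) →-dec (degIn G S v ≤? k))

allSubsets : ∀ n → List (Subset n)
allSubsets zero = V.[] ∷ []
allSubsets (suc n) = map (true V.∷_) (allSubsets n) ++ map (false V.∷_) (allSubsets n)

α : ∀ {n} → ℕ → Graph n → ℕ
α {n} k G = foldr _⊔_ 0 (map ∣_∣ (filter (KIndep? k G) (allSubsets n)))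

-- Lower bounds on f(k,d) = inf { α_k(G)/n(G) : d(G) ≤ d }.
-- "f(k,d) ≥ p/q" (q ≥ 1) holds iff every graph G on n ≥ 1 vertices
-- with d(G) ≤ d satisfies α_k(G)/n ≥ p/q, i.e. p * n ≤ q * α_k(G).

f≥ : ℕ → ℕ → ℕ → ℕ → Set
f≥ k d p q = ∀ n → 1 ≤ n → (G : Graph n) → AvgDeg≤ G d → p * n ≤ q * α k G

-- The graph K_{1,k+1} ∪ k K_1 on 2k+2 vertices:
-- vertex 0 is the centre, vertices 1..k+1 the leaves, the rest isolated.

starEdge : ℕ → ℕ → ℕ → Bool
starEdge k a b = (a ≡ᵇ 0) ∧ ((1 ≤ᵇ b) ∧ (b ≤ᵇ suc k))

private
  starEdge-irr : ∀ k a → starEdge k a a ≡ false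
  starEdge-irr k zero = refl
  starEdge-irr k (suc a) = refl

  ∨-false : ∀ {b} → b ≡ false → (b ∨ b) ≡ false
  ∨-false refl = refl

starGraph : (k : ℕ) → Graph (suc k + suc k)
starGraph k = record
  { adj    = λ u v → starEdge k (toℕ u) (toℕ v) ∨ starEdge k (toℕ v) (toℕ u)
  ; sym    = λ u v → ∨-comm (starEdge k (toℕ u) (toℕ v)) (starEdge k (toℕ v) (toℕ u))
  ; irrefl = λ v → ∨-false (starEdge-irr k (toℕ v))
  }

-- For every m, a graph G on n vertices with e edges satisfies
--   2m(k+1)·n ≤ m(m+1)(k+1)·α_k(G) + 2e,
-- by induction on m and on n. If some vertex has degree ≥ m(k+1), deleting it costs one
-- vertex but at least 2m(k+1) in 2e. Otherwise the maximum degree is at most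
-- k + (m−1)(k+1), and Lovász's partition lemma (a graph of maximum degree ≤ s+t+1 splits into
-- parts of maximum degree ≤ s and ≤ t; minimise (t+1)·2e(A) + (s+1)·2e(B)) splits G into m
-- k-independent sets, so n ≤ m·α_k(G); averaging with the bound for m−1 closes the induction.
-- With 2e ≤ dn, the choice m = (d+t)/(k+1) gives (1), m = 1 gives (2), and (3) is (1) at
-- d = ⌈d(G)⌉. In K_{1,k+1} ∪ kK₁ a k-independent set misses the centre or a leaf, so α_k = 2k+1.

module Submission where

open import Defs renaming (sym to adj-sym)

open import Data.Bool using (Bool; true; false; _∧_; _∨_; not)
open import Data.Bool.Properties using (∧-identityʳ; ∨-identityʳ) renaming (_≟_ to _≟ᵇ_)
open import Data.Fin using (Fin; zero; suc; toℕ)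
open import Data.Fin.Properties using (_≟_; any?)
open import Data.Fin.Subset using (Subset; ∣_∣)
open import Data.Fin.Subset.Properties using (∣p∣≤n)
open import Data.List using (allFin; foldr)
import Data.List as List using (map; tabulate)
open import Data.List.Membership.Propositional using (_∈_)
open import Data.List.Membership.Propositional.Properties using (∈-map⁺; ∈-++⁺ˡ; ∈-++⁺ʳ; ∈-filter⁺)
open import Data.List.Properties using (map-tabulate; foldr-preservesᵇ; foldr-preservesᵒ)
import Data.List.Relation.Unary.All as All
import Data.List.Relation.Unary.All.Properties as All
open import Data.List.Relation.Unary.All.Properties using (all-filter)
open import Data.List.Relation.Unary.Any using (here)
import Data.List.Relation.Unary.Any as Any
open import Data.Nat
  using (ℕ; zero; suc; _+_; _*_; _∸_; _%_; _/_; _⊔_; _≤_; _<_; _<ᵇ_; _≤?_; _<?_; z≤n; s≤s; z<s;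
         NonZero; >-nonZero; >-nonZero⁻¹)
open import Data.Nat.DivMod using (m≡m%n+[m/n]*n; %-distribˡ-+; n%n≡0; m%n<n; m%n%n≡m%n)
open import Data.Nat.Induction using (<-wellFounded)
import Data.Nat.ListAction as ListAction
open import Data.Nat.Properties hiding (_≟_)
open import Algebra.Properties.Semiring.Sum +-*-semiring
  using (sum; sum-syntax; sum-cong-≗; sum-replicate-zero; ∑-distrib-+; ∑-comm)
open import Data.Nat.Solver using (module +-*-Solver)
open +-*-Solver using (solve; _:+_; _:*_; _:=_; con)
open import Data.Product using (∃; ∃₂; _×_; _,_)
open import Data.Sum using (inj₂; [_,_])
open import Data.Vec using ([]; _∷_; tabulate; lookup)
import Data.Vec as Vec
open import Data.Vec.Properties using (lookup∘tabulate; []=⇒lookup)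
open import Function using (_∘_; id)
open import Induction.WellFounded using (Acc; acc)
open import Relation.Binary.PropositionalEquality
  using (_≡_; refl; sym; trans; cong; cong₂; subst; subst₂; module ≡-Reasoning)
open import Relation.Nullary using (¬_; yes; no; does; contradiction)
open import Relation.Nullary.Decidable using (_×-dec_)

∑-mono-≤ : ∀ {n} {f g : Fin n → ℕ} → (∀ i → f i ≤ g i) → ∑[ i < n ] f i ≤ ∑[ i < n ] g i
∑-mono-≤ {zero}  f≤g = z≤n
∑-mono-≤ {suc n} f≤g = +-mono-≤ (f≤g zero) (∑-mono-≤ (f≤g ∘ suc))

∑-const-1 : ∀ n → ∑[ i < n ] 1 ≡ n
∑-const-1 zero    = refl
∑-const-1 (suc n) = cong suc (∑-const-1 n)

δ : ∀ {n} → Fin n → Fin n → ℕ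
δ u v = 𝟙 (does (u ≟ v))

∑-δ : ∀ {n} (f : Fin n → ℕ) v → ∑[ u < n ] (δ u v * f u) ≡ f v
∑-δ {suc n} f zero = trans (cong₂ _+_ (+-identityʳ (f zero)) (sum-replicate-zero n)) (+-identityʳ (f zero))
∑-δ {suc n} f (suc v) = ∑-δ (f ∘ suc) v

𝟙-∧ : ∀ a b → 𝟙 (a ∧ b) ≡ 𝟙 a * 𝟙 b
𝟙-∧ true  b = sym (+-identityʳ (𝟙 b))
𝟙-∧ false b = refl

𝟙≤1 : ∀ b → 𝟙 b ≤ 1
𝟙≤1 true  = ≤-refl
𝟙≤1 false = z≤n

∑-<ᵇ-≤ : ∀ N M → ∑[ i < N ] 𝟙 (toℕ i <ᵇ M) ≤ M
∑-<ᵇ-≤ zero    M       = z≤n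
∑-<ᵇ-≤ (suc N) zero    = ∑-<ᵇ-≤ N zero
∑-<ᵇ-≤ (suc N) (suc M) = s≤s (∑-<ᵇ-≤ N M)

𝟙-∨ : ∀ a b → 𝟙 (a ∨ b) ≤ 𝟙 a + 𝟙 b
𝟙-∨ true  b = s≤s z≤n
𝟙-∨ false b = ≤-refl

sum-allFin : ∀ {n} (f : Fin n → ℕ) → ListAction.sum (List.map f (allFin n)) ≡ ∑[ i < n ] f i
sum-allFin {n} f = trans (cong ListAction.sum (map-tabulate {n = n} id f)) (sum-tabulate f)
  where
  sum-tabulate : ∀ {m} (g : Fin m → ℕ) → ListAction.sum (List.tabulate g) ≡ ∑[ i < m ] g i
  sum-tabulate {zero}  g = refl
  sum-tabulate {suc m} g = cong (g zero +_) (sum-tabulate (g ∘ suc))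

∈-allSubsets : ∀ {n} (p : Subset n) → p ∈ allSubsets n
∈-allSubsets []                  = here refl
∈-allSubsets (true ∷ p)          = ∈-++⁺ˡ (∈-map⁺ (true ∷_) (∈-allSubsets p))
∈-allSubsets {suc n} (false ∷ p) = ∈-++⁺ʳ (List.map (true ∷_) (allSubsets n)) (∈-map⁺ (false ∷_) (∈-allSubsets p))

∈⇒≤foldr-⊔ : ∀ {x xs} → x ∈ xs → x ≤ foldr _⊔_ 0 xs
∈⇒≤foldr-⊔ {x} {xs} x∈xs = foldr-preservesᵒ {P = x ≤_}
  (λ a b → [ m≤n⇒m≤n⊔o b , m≤n⇒m≤o⊔n a ]) 0 xs (inj₂ (Any.map ≤-reflexive x∈xs))

KIndep⇒∣p∣≤α : ∀ {n k} (G : Graph n) (p : Subset n) → KIndep k G p → ∣ p ∣ ≤ α k G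
KIndep⇒∣p∣≤α {k = k} G p p-indep =
  ∈⇒≤foldr-⊔ (∈-map⁺ ∣_∣ (∈-filter⁺ (KIndep? k G) (∈-allSubsets p) p-indep))

α≤ : ∀ {n k B} (G : Graph n) → (∀ p → KIndep k G p → ∣ p ∣ ≤ B) → α k G ≤ B
α≤ {n} {k} G bound =
  foldr-preservesᵇ {P = _≤ _} ⊔-lub z≤n (All.map⁺ (All.map (bound _) (all-filter (KIndep? k G) (allSubsets n))))

∣tabulate∣ : ∀ {n} (X : Fin n → Bool) → ∣ tabulate X ∣ ≡ ∑[ u < n ] 𝟙 (X u)
∣tabulate∣ {zero}  X = refl
∣tabulate∣ {suc n} X with X zero
... | true  = cong suc (∣tabulate∣ (X ∘ suc))
... | false = ∣tabulate∣ (X ∘ suc)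

∣p∣≤m∸M+∣p∩<M∣ : ∀ {m} (p : Subset m) M → ∣ p ∣ ≤ m ∸ M + ∑[ i < m ] 𝟙 ((toℕ i <ᵇ M) ∧ lookup p i)
∣p∣≤m∸M+∣p∩<M∣ []          M       = z≤n
∣p∣≤m∸M+∣p∩<M∣ {suc m} p   zero    =
  subst (∣ p ∣ ≤_) (sym (trans (cong (suc m +_) (sum-replicate-zero (suc m))) (+-identityʳ (suc m)))) (∣p∣≤n p)
∣p∣≤m∸M+∣p∩<M∣ {suc m} (true ∷ p)  (suc M) = subst (suc ∣ p ∣ ≤_) (sym (+-suc (m ∸ M) _)) (s≤s (∣p∣≤m∸M+∣p∩<M∣ p M))
∣p∣≤m∸M+∣p∩<M∣ {suc m} (false ∷ p) (suc M) = ∣p∣≤m∸M+∣p∩<M∣ p M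

exchange-< : ∀ {s t a b} X Y → a + b ≤ s + t + 1 → s < a →
             suc t * X + suc s * (Y + 2 * b) < suc t * (X + 2 * a) + suc s * Y
exchange-< {s} {t} {a} {b} X Y a+b≤ s<a = subst₂ _<_ (sym expandˡ) (sym expandʳ)
  (+-monoʳ-< (suc t * X + suc s * Y) (*-monoʳ-< 2 sb<ta))
  where
  b≤t : b ≤ t
  b≤t = +-cancelˡ-≤ (suc s) b t (begin
    suc s + b ≤⟨ +-monoˡ-≤ b s<a ⟩
    a + b     ≤⟨ a+b≤ ⟩
    s + t + 1 ≡⟨ +-comm (s + t) 1 ⟩
    suc s + t ∎)
    where open ≤-Reasoning
  sb<ta : suc s * b < suc t * a
  sb<ta = begin-strict
    suc s * b     ≤⟨ *-monoʳ-≤ (suc s) b≤t ⟩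
    suc s * t     <⟨ *-monoʳ-< (suc s) (n<1+n t) ⟩
    suc s * suc t ≤⟨ *-monoˡ-≤ (suc t) s<a ⟩
    a * suc t     ≡⟨ *-comm a (suc t) ⟩
    suc t * a     ∎
    where open ≤-Reasoning
  expandˡ : suc t * X + suc s * (Y + 2 * b) ≡ suc t * X + suc s * Y + 2 * (suc s * b)
  expandˡ = solve 5 (λ b s t X Y → (con 1 :+ t) :* X :+ (con 1 :+ s) :* (Y :+ con 2 :* b)
                      := (con 1 :+ t) :* X :+ (con 1 :+ s) :* Y :+ con 2 :* ((con 1 :+ s) :* b)) refl b s t X Y
  expandʳ : suc t * (X + 2 * a) + suc s * Y ≡ suc t * X + suc s * Y + 2 * (suc t * a)
  expandʳ = solve 5 (λ a s t X Y → (con 1 :+ t) :* (X :+ con 2 :* a) :+ (con 1 :+ s) :* Y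
                      := (con 1 :+ t) :* X :+ (con 1 :+ s) :* Y :+ con 2 :* ((con 1 :+ t) :* a)) refl a s t X Y

module Induced {n : ℕ} (G : Graph n) where

  VSet : Set
  VSet = Fin n → Bool

  size : VSet → ℕ
  size X = ∑[ u < n ] 𝟙 (X u)

  nbrSum : Fin n → (Fin n → ℕ) → ℕ
  nbrSum w f = ∑[ u < n ] (f u * 𝟙 (adj G w u))

  nbrs : VSet → Fin n → ℕ
  nbrs X w = nbrSum w (𝟙 ∘ X)

  degSumIn : VSet → ℕ
  degSumIn X = ∑[ w < n ] (𝟙 (X w) * nbrs X w)

  Δ[_]≤_ : VSet → ℕ → Set
  Δ[ X ]≤ s = ∀ v → X v ≡ true → nbrs X v ≤ s

  -- Additivity of the indicators makes the pieces disjoint.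
  record _⊕_≐_ (X : VSet) (v : Fin n) (Y : VSet) : Set where
    constructor mk⊕
    field 𝟙-⊕ : ∀ u → 𝟙 (Y u) ≡ 𝟙 (X u) + δ u v

  record Partition (U A B : VSet) : Set where
    constructor mkPartition
    field 𝟙-split : ∀ u → 𝟙 (U u) ≡ 𝟙 (A u) + 𝟙 (B u)

  open _⊕_≐_
  open Partition

  nbrSum-+ : ∀ w (f g : Fin n → ℕ) → nbrSum w (λ u → f u + g u) ≡ nbrSum w f + nbrSum w g
  nbrSum-+ w f g = trans (sum-cong-≗ λ u → *-distribʳ-+ (𝟙 (adj G w u)) (f u) (g u))
                         (∑-distrib-+ (λ u → f u * 𝟙 (adj G w u)) (λ u → g u * 𝟙 (adj G w u)))

  nbrs-split : ∀ {Y} (f g : Fin n → ℕ) → (∀ u → 𝟙 (Y u) ≡ f u + g u) →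
               ∀ w → nbrs Y w ≡ nbrSum w f + nbrSum w g
  nbrs-split f g Y≗f+g w =
    trans (sum-cong-≗ λ u → cong (_* 𝟙 (adj G w u)) (Y≗f+g u)) (nbrSum-+ w f g)

  nbrs-⊕ : ∀ {X v Y} → X ⊕ v ≐ Y → ∀ w → nbrs Y w ≡ nbrs X w + 𝟙 (adj G w v)
  nbrs-⊕ {X} {v} X⊕v w =
    trans (nbrs-split (𝟙 ∘ X) (λ u → δ u v) (𝟙-⊕ X⊕v) w) (cong (nbrs X w +_) (∑-δ (𝟙 ∘ adj G w) v))

  nbrs-⊕-self : ∀ {X v Y} → X ⊕ v ≐ Y → nbrs Y v ≡ nbrs X v
  nbrs-⊕-self {X} {v} {Y} X⊕v = begin
    nbrs Y v                   ≡⟨ nbrs-⊕ X⊕v v ⟩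
    nbrs X v + 𝟙 (adj G v v)   ≡⟨ cong (λ b → nbrs X v + 𝟙 b) (irrefl G v) ⟩
    nbrs X v + 0               ≡⟨ +-identityʳ (nbrs X v) ⟩
    nbrs X v                   ∎
    where open ≡-Reasoning

  nbrs-partition : ∀ {U A B} → Partition U A B → ∀ w → nbrs U w ≡ nbrs A w + nbrs B w
  nbrs-partition {A = A} {B} p = nbrs-split (𝟙 ∘ A) (𝟙 ∘ B) (𝟙-split p)

  size-⊕ : ∀ {X v Y} → X ⊕ v ≐ Y → size Y ≡ size X + 1
  size-⊕ {X} {v} X⊕v =
    trans (sum-cong-≗ (𝟙-⊕ X⊕v)) (trans (∑-distrib-+ (𝟙 ∘ X) (λ u → δ u v)) (cong (size X +_) ∑δ≡1))
    where
    ∑δ≡1 : ∑[ u < n ] δ u v ≡ 1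
    ∑δ≡1 = trans (sum-cong-≗ λ u → sym (*-identityʳ (δ u v))) (∑-δ (λ _ → 1) v)

  size-partition : ∀ {U A B} → Partition U A B → size U ≡ size A + size B
  size-partition {A = A} {B} p = trans (sum-cong-≗ (𝟙-split p)) (∑-distrib-+ (𝟙 ∘ A) (𝟙 ∘ B))

  degSumIn-⊕ : ∀ {X v Y} → X ⊕ v ≐ Y → degSumIn Y ≡ degSumIn X + 2 * nbrs X v
  degSumIn-⊕ {X} {v} {Y} X⊕v = begin
    ∑[ w < n ] (𝟙 (Y w) * nbrs Y w)
      ≡⟨ sum-cong-≗ (λ w → cong₂ _*_ (𝟙-⊕ X⊕v w) (nbrs-⊕ X⊕v w)) ⟩
    ∑[ w < n ] ((𝟙 (X w) + δ w v) * (nbrs X w + 𝟙 (adj G w v)))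
      ≡⟨ sum-cong-≗ (λ w → expand (𝟙 (X w)) (δ w v) (nbrs X w) (𝟙 (adj G w v))) ⟩
    ∑[ w < n ] (t₁ w + t₂ w + t₃ w + t₄ w)
      ≡⟨ trans (∑-distrib-+ (λ w → t₁ w + t₂ w + t₃ w) t₄)
               (cong (_+ sum t₄) (trans (∑-distrib-+ (λ w → t₁ w + t₂ w) t₃) (cong (_+ sum t₃) (∑-distrib-+ t₁ t₂)))) ⟩
    degSumIn X + sum t₂ + sum t₃ + sum t₄
      ≡⟨ cong₂ _+_ (cong₂ _+_ (cong (degSumIn X +_) (sum-cong-≗ λ w → cong (λ b → 𝟙 (X w) * 𝟙 b) (adj-sym G w v)))
                              (∑-δ (nbrs X) v))
                   (trans (∑-δ (λ w → 𝟙 (adj G w v)) v) (cong 𝟙 (irrefl G v))) ⟩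
    degSumIn X + nbrs X v + nbrs X v + 0
      ≡⟨ solve 2 (λ D d → D :+ d :+ d :+ con 0 := D :+ con 2 :* d) refl (degSumIn X) (nbrs X v) ⟩
    degSumIn X + 2 * nbrs X v ∎
    where
    open ≡-Reasoning
    t₁ t₂ t₃ t₄ : Fin n → ℕ
    t₁ w = 𝟙 (X w) * nbrs X w
    t₂ w = 𝟙 (X w) * 𝟙 (adj G w v)
    t₃ w = δ w v * nbrs X w
    t₄ w = δ w v * 𝟙 (adj G w v)
    expand : ∀ x e d a → (x + e) * (d + a) ≡ x * d + x * a + e * d + e * a
    expand = solve 4 (λ x e d a → (x :+ e) :* (d :+ a) := x :* d :+ x :* a :+ e :* d :+ e :* a) refl

  remove : VSet → Fin n → VSet
  remove X v u = X u ∧ not (does (u ≟ v))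

  insert : VSet → Fin n → VSet
  insert X v u = X u ∨ does (u ≟ v)

  remove-⊕ : ∀ {X v} → X v ≡ true → remove X v ⊕ v ≐ X
  remove-⊕ {X} {v} Xv = mk⊕ 𝟙-remove
    where
    𝟙-remove : ∀ u → 𝟙 (X u) ≡ 𝟙 (remove X v u) + δ u v
    𝟙-remove u with u ≟ v
    ... | yes refl rewrite Xv = refl
    ... | no _     rewrite ∧-identityʳ (X u) = sym (+-identityʳ (𝟙 (X u)))

  insert-⊕ : ∀ {X v} → X v ≡ false → X ⊕ v ≐ insert X v
  insert-⊕ {X} {v} Xv = mk⊕ 𝟙-insert
    where
    𝟙-insert : ∀ u → 𝟙 (insert X v u) ≡ 𝟙 (X u) + δ u v
    𝟙-insert u with u ≟ v
    ... | yes refl rewrite Xv = refl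
    ... | no _     rewrite ∨-identityʳ (X u) = sym (+-identityʳ (𝟙 (X u)))

  partition-swap : ∀ {U A B} → Partition U A B → Partition U B A
  partition-swap {A = A} {B} p = mkPartition λ u → trans (𝟙-split p u) (+-comm (𝟙 (A u)) (𝟙 (B u)))

  partition-⊆ : ∀ {U A B v} → Partition U A B → A v ≡ true → U v ≡ true
  partition-⊆ {U} {v = v} p Av with U v | 𝟙-split p v
  ... | true  | _     = refl
  ... | false | 0≡1+b rewrite Av = contradiction 0≡1+b λ ()

  partition-disjoint : ∀ {U A B v} → Partition U A B → A v ≡ true → B v ≡ false
  partition-disjoint {U} {B = B} {v} p Av with B v | 𝟙-split p v
  ... | false | _   = refl
  ... | true  | U≡2 rewrite Av = contradiction (subst (_≤ 1) U≡2 (𝟙≤1 (U v))) λ { (s≤s ()) }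

  partition-move : ∀ {U A B v} → Partition U A B → A v ≡ true → Partition U (remove A v) (insert B v)
  partition-move {U} {A} {B} {v} p Av = mkPartition λ u → begin
    𝟙 (U u)                               ≡⟨ 𝟙-split p u ⟩
    𝟙 (A u) + 𝟙 (B u)                     ≡⟨ cong (_+ 𝟙 (B u)) (𝟙-⊕ (remove-⊕ Av) u) ⟩
    𝟙 (remove A v u) + δ u v + 𝟙 (B u)    ≡⟨ +-assoc (𝟙 (remove A v u)) (δ u v) (𝟙 (B u)) ⟩
    𝟙 (remove A v u) + (δ u v + 𝟙 (B u))  ≡⟨ cong (𝟙 (remove A v u) +_) (+-comm (δ u v) (𝟙 (B u))) ⟩
    𝟙 (remove A v u) + (𝟙 (B u) + δ u v)  ≡⟨ cong (𝟙 (remove A v u) +_) (𝟙-⊕ (insert-⊕ (partition-disjoint p Av)) u) ⟨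
    𝟙 (remove A v u) + 𝟙 (insert B v u)   ∎
    where open ≡-Reasoning

  potential : ℕ → ℕ → VSet → VSet → ℕ
  potential s t A B = suc t * degSumIn A + suc s * degSumIn B

  potential-move-< : ∀ {U A B v s t} → Partition U A B → Δ[ U ]≤ (s + t + 1) →
                     A v ≡ true → s < nbrs A v →
                     potential s t (remove A v) (insert B v) < potential s t A B
  potential-move-< {U} {A} {B} {v} {s} {t} p ΔU Av s<deg =
    subst₂ _<_ (cong (λ D → suc t * degSumIn A′ + suc s * D) (sym (degSumIn-⊕ B⊕v)))
               (cong (λ D → suc t * D + suc s * degSumIn B) (sym (degSumIn-⊕ A′⊕v)))
      (exchange-< (degSumIn A′) (degSumIn B) deg≤ (subst (s <_) (nbrs-⊕-self A′⊕v) s<deg))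
    where
    A′ = remove A v
    A′⊕v : A′ ⊕ v ≐ A
    A′⊕v = remove-⊕ Av
    B⊕v : B ⊕ v ≐ insert B v
    B⊕v = insert-⊕ (partition-disjoint p Av)
    deg≤ : nbrs A′ v + nbrs B v ≤ s + t + 1
    deg≤ = begin
      nbrs A′ v + nbrs B v ≡⟨ cong (_+ nbrs B v) (nbrs-⊕-self A′⊕v) ⟨
      nbrs A v + nbrs B v  ≡⟨ nbrs-partition p v ⟨
      nbrs U v             ≤⟨ ΔU v (partition-⊆ p Av) ⟩
      s + t + 1            ∎
      where open ≤-Reasoning

  lovász-partition : ∀ U s t → Δ[ U ]≤ (s + t + 1) →
                     ∃₂ λ A B → Partition U A B × Δ[ A ]≤ s × Δ[ B ]≤ t
  lovász-partition U s t ΔU =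
    descend U (λ _ → false) (mkPartition λ u → sym (+-identityʳ (𝟙 (U u)))) (<-wellFounded _)
    where
    ΔU′ : Δ[ U ]≤ (t + s + 1)
    ΔU′ v Uv = subst (λ r → nbrs U v ≤ r + 1) (+-comm s t) (ΔU v Uv)

    sparse : ∀ {X r} → ¬ ∃ (λ v → X v ≡ true × r < nbrs X v) → Δ[ X ]≤ r
    sparse none v Xv = ≮⇒≥ λ r< → none (v , Xv , r<)

    descend : ∀ A B → Partition U A B → Acc _<_ (potential s t A B) →
              ∃₂ λ A B → Partition U A B × Δ[ A ]≤ s × Δ[ B ]≤ t
    descend A B p (acc rec) with any? (λ v → (A v ≟ᵇ true) ×-dec (s <? nbrs A v))
    ... | yes (v , Av , s<) =
      descend (remove A v) (insert B v) (partition-move p Av) (rec (potential-move-< p ΔU Av s<))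
    ... | no A-sparse with any? (λ v → (B v ≟ᵇ true) ×-dec (t <? nbrs B v))
    ...   | yes (v , Bv , t<) =
      descend (insert A v) (remove B v) (partition-swap (partition-move (partition-swap p) Bv))
        (rec (subst₂ _<_ (+-comm (suc s * degSumIn (remove B v)) (suc t * degSumIn (insert A v)))
                         (+-comm (suc s * degSumIn B) (suc t * degSumIn A))
                         (potential-move-< (partition-swap p) ΔU′ Bv t<)))
    ...   | no B-sparse = A , B , p , sparse A-sparse , sparse B-sparse

  degIn-tabulate : ∀ S v → degIn G (tabulate S) v ≡ nbrs S v
  degIn-tabulate S v = trans (sum-allFin (λ u → 𝟙 (adj G v u ∧ lookup (tabulate S) u))) (sum-cong-≗ λ u → begin
    𝟙 (adj G v u ∧ lookup (tabulate S) u) ≡⟨ cong (λ b → 𝟙 (adj G v u ∧ b)) (lookup∘tabulate S u) ⟩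
    𝟙 (adj G v u ∧ S u)                   ≡⟨ 𝟙-∧ (adj G v u) (S u) ⟩
    𝟙 (adj G v u) * 𝟙 (S u)               ≡⟨ *-comm (𝟙 (adj G v u)) (𝟙 (S u)) ⟩
    𝟙 (S u) * 𝟙 (adj G v u)               ∎)
    where open ≡-Reasoning

  size≤α : ∀ {k S} → Δ[ S ]≤ k → size S ≤ α k G
  size≤α {k} {S} ΔS = subst (_≤ α k G) (∣tabulate∣ S) (KIndep⇒∣p∣≤α G (tabulate S) S-indep)
    where
    S-indep : KIndep k G (tabulate S)
    S-indep v v∈S = subst (_≤ k) (sym (degIn-tabulate S v))
                      (ΔS v (trans (sym (lookup∘tabulate S v)) ([]=⇒lookup v∈S)))

  degSumIn-all : degSumIn (λ _ → true) ≡ degSum G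
  degSumIn-all = sym (trans (sum-allFin (deg G)) (sum-cong-≗ λ w →
    trans (sum-allFin (λ u → 𝟙 (adj G w u)))
          (trans (sum-cong-≗ λ u → sym (*-identityˡ (𝟙 (adj G w u)))) (sym (*-identityˡ (nbrs (λ _ → true) w))))))

  module _ (k : ℕ) where

    bounded-degree⇒size≤ : ∀ j U → Δ[ U ]≤ (k + j * suc k) → size U ≤ suc j * α k G
    bounded-degree⇒size≤ zero U ΔU =
      subst (size U ≤_) (sym (+-identityʳ (α k G))) (size≤α λ v Uv → subst (nbrs U v ≤_) (+-identityʳ k) (ΔU v Uv))
    bounded-degree⇒size≤ (suc j) U ΔU with lovász-partition U k (k + j * suc k) ΔU′
      where
      ΔU′ : Δ[ U ]≤ (k + (k + j * suc k) + 1)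
      ΔU′ v Uv = subst (nbrs U v ≤_) (solve 2 (λ k j → k :+ (con 1 :+ k :+ j :* (con 1 :+ k))
                                                := k :+ (k :+ j :* (con 1 :+ k)) :+ con 1) refl k j) (ΔU v Uv)
    ... | A , B , p , ΔA , ΔB = begin
      size U          ≡⟨ size-partition p ⟩
      size A + size B ≤⟨ +-mono-≤ (size≤α ΔA) (bounded-degree⇒size≤ j B ΔB) ⟩
      α k G + suc j * α k G ∎
      where open ≤-Reasoning

    size-degSumIn-bound : ∀ m U → 2 * m * suc k * size U ≤ m * suc m * suc k * α k G + degSumIn U
    size-degSumIn-bound m U = bound m U (<-wellFounded (size U))
      where
      c = suc k
      a = α k G

      bound : ∀ m U → Acc _<_ (size U) → 2 * m * c * size U ≤ m * suc m * c * a + degSumIn U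
      bound zero U _ = z≤n
      bound (suc j) U (acc rec) with any? (λ v → (U v ≟ᵇ true) ×-dec (suc j * c ≤? nbrs U v))
      ... | yes (v , Uv , high) = begin
        2 * suc j * c * size U                       ≡⟨ cong (2 * suc j * c *_) (size-⊕ U′⊕v) ⟩
        2 * suc j * c * (size U′ + 1)                ≡⟨ *-distribˡ-+ (2 * suc j * c) (size U′) 1 ⟩
        2 * suc j * c * size U′ + 2 * suc j * c * 1  ≤⟨ +-mono-≤ (bound (suc j) U′ (rec U′<U)) gain ⟩
        R + degSumIn U′ + 2 * nbrs U′ v              ≡⟨ +-assoc R (degSumIn U′) (2 * nbrs U′ v) ⟩
        R + (degSumIn U′ + 2 * nbrs U′ v)            ≡⟨ cong (R +_) (degSumIn-⊕ U′⊕v) ⟨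
        R + degSumIn U                               ∎
        where
        open ≤-Reasoning
        R = suc j * suc (suc j) * c * a
        U′ = remove U v
        U′⊕v : U′ ⊕ v ≐ U
        U′⊕v = remove-⊕ Uv
        U′<U : size U′ < size U
        U′<U = subst (size U′ <_) (sym (size-⊕ U′⊕v)) (m<m+n (size U′) z<s)
        gain : 2 * suc j * c * 1 ≤ 2 * nbrs U′ v
        gain = subst (_≤ 2 * nbrs U′ v)
                 (solve 2 (λ j c → con 2 :* ((con 1 :+ j) :* c) := con 2 :* (con 1 :+ j) :* c :* con 1) refl j c)
                 (*-monoʳ-≤ 2 (subst (suc j * c ≤_) (nbrs-⊕-self U′⊕v) high))
      ... | no low = begin
        2 * suc j * c * size U                               ≡⟨ split-2 ⟩
        2 * j * c * size U + 2 * c * size U                  ≤⟨ +-mono-≤ (bound j U (acc rec)) (*-monoʳ-≤ (2 * c) small) ⟩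
        j * suc j * c * a + degSumIn U + 2 * c * (suc j * a) ≡⟨ merge ⟩
        suc j * suc (suc j) * c * a + degSumIn U             ∎
        where
        open ≤-Reasoning
        small : size U ≤ suc j * a
        small = bounded-degree⇒size≤ j U λ v Uv → ≤-pred (≰⇒> λ high → low (v , Uv , high))
        split-2 : 2 * suc j * c * size U ≡ 2 * j * c * size U + 2 * c * size U
        split-2 = solve 3 (λ j c x → con 2 :* (con 1 :+ j) :* c :* x := con 2 :* j :* c :* x :+ con 2 :* c :* x) refl j c (size U)
        merge : j * suc j * c * a + degSumIn U + 2 * c * (suc j * a) ≡ suc j * suc (suc j) * c * a + degSumIn U
        merge = solve 4 (λ j c a D → j :* (con 1 :+ j) :* c :* a :+ D :+ con 2 :* c :* ((con 1 :+ j) :* a)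
                                     := (con 1 :+ j) :* (con 2 :+ j) :* c :* a :+ D) refl j c a (degSumIn U)

    degSum-bound : ∀ m → 2 * m * suc k * n ≤ m * suc m * suc k * α k G + degSum G
    degSum-bound m = subst₂ (λ x D → 2 * m * suc k * x ≤ m * suc m * suc k * α k G + D)
                       (∑-const-1 n) degSumIn-all (size-degSumIn-bound m (λ _ → true))

open Induced using (degSum-bound)

divisible-bound : ∀ {k d t m n a D} → d + t ≡ m * suc k →
                  2 * m * suc k * n ≤ m * suc m * suc k * a + D → D ≤ d * n →
                  suc k * (d + 2 * t) * n ≤ (d + k + t + 1) * (d + t) * a
divisible-bound {k} {d} {t} {m} {n} {a} {D} d+t≡mc bound D≤dn = +-cancelʳ-≤ (c * (d * n)) _ _ (begin
  c * (d + 2 * t) * n + c * (d * n)           ≡⟨ p≡ ⟩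
  c * (2 * m * c * n)                         ≤⟨ *-monoʳ-≤ c (≤-trans bound (+-monoʳ-≤ _ D≤dn)) ⟩
  c * (m * suc m * c * a + d * n)             ≡⟨ *-distribˡ-+ c (m * suc m * c * a) (d * n) ⟩
  c * (m * suc m * c * a) + c * (d * n)       ≡⟨ cong (_+ c * (d * n)) q≡ ⟨
  (d + k + t + 1) * (d + t) * a + c * (d * n) ∎)
  where
  open ≤-Reasoning
  c = suc k
  p≡ : c * (d + 2 * t) * n + c * (d * n) ≡ c * (2 * m * c * n)
  p≡ = begin-equality
    c * (d + 2 * t) * n + c * (d * n) ≡⟨ solve 4 (λ c d t n → c :* (d :+ con 2 :* t) :* n :+ c :* (d :* n)
                                                    := c :* (con 2 :* (d :+ t) :* n)) refl c d t n ⟩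
    c * (2 * (d + t) * n)             ≡⟨ cong (λ x → c * (2 * x * n)) d+t≡mc ⟩
    c * (2 * (m * c) * n)             ≡⟨ solve 3 (λ c m n → c :* (con 2 :* (m :* c) :* n)
                                                    := c :* (con 2 :* m :* c :* n)) refl c m n ⟩
    c * (2 * m * c * n)               ∎
  q≡ : (d + k + t + 1) * (d + t) * a ≡ c * (m * suc m * c * a)
  q≡ = begin-equality
    (d + k + t + 1) * (d + t) * a ≡⟨ cong (λ x → x * (d + t) * a)
                                         (solve 3 (λ d k t → d :+ k :+ t :+ con 1 := d :+ t :+ (con 1 :+ k)) refl d k t) ⟩
    (d + t + c) * (d + t) * a     ≡⟨ cong (λ x → (x + c) * x * a) d+t≡mc ⟩
    (m * c + c) * (m * c) * a     ≡⟨ solve 3 (λ m c a → (m :* c :+ c) :* (m :* c) :* a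
                                                := c :* (m :* (con 1 :+ m) :* c :* a)) refl m c a ⟩
    c * (m * suc m * c * a)       ∎

residue-complement⇒divisible : ∀ {c d t} .{{_ : NonZero c}} → t ≤ c → d % c ≡ (c ∸ t) % c →
                               d + t ≡ (d + t) / c * c
residue-complement⇒divisible {c} {d} {t} t≤c d≡-t = begin
  d + t                           ≡⟨ m≡m%n+[m/n]*n (d + t) c ⟩
  (d + t) % c + (d + t) / c * c   ≡⟨ cong (_+ (d + t) / c * c) [d+t]%c≡0 ⟩
  (d + t) / c * c                 ∎
  where
  open ≡-Reasoning
  [d+t]%c≡0 : (d + t) % c ≡ 0
  [d+t]%c≡0 = begin
    (d + t) % c                  ≡⟨ %-distribˡ-+ d t c ⟩
    (d % c + t % c) % c          ≡⟨ cong (λ x → (x + t % c) % c) d≡-t ⟩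
    ((c ∸ t) % c + t % c) % c    ≡⟨ %-distribˡ-+ (c ∸ t) t c ⟨
    (c ∸ t + t) % c              ≡⟨ cong (_% c) (m∸n+n≡m t≤c) ⟩
    c % c                        ≡⟨ n%n≡0 c ⟩
    0                            ∎

f≥-residue : ∀ k d t → t ≤ suc k → d % suc k ≡ (suc k ∸ t) % suc k →
             f≥ k d (suc k * (d + 2 * t)) ((d + k + t + 1) * (d + t))
f≥-residue k d t t≤c d≡-t n _ G avg =
  divisible-bound {k} {d} {t} {m} (residue-complement⇒divisible {suc k} {d} {t} t≤c d≡-t) (degSum-bound G k m) avg
  where m = (d + t) / suc k

residue-bound≥[k+1]/[d+k+1] : ∀ k d t → t ≤ suc k →
                              suc k * ((d + k + t + 1) * (d + t)) ≤ suc k * (d + 2 * t) * (d + k + 1)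
residue-bound≥[k+1]/[d+k+1] k d t t≤c = subst₂ _≤_ (sym lhs) (sym rhs) (m≤m+n _ _)
  where
  r = suc k ∸ t
  c≡t+r : suc k ≡ t + r
  c≡t+r = sym (m+[n∸m]≡n t≤c)
  lhs : suc k * ((d + k + t + 1) * (d + t)) ≡ (t + r) * ((d + t + (t + r)) * (d + t))
  lhs = trans (cong (λ x → suc k * (x * (d + t))) (solve 3 (λ d k t → d :+ k :+ t :+ con 1 := d :+ t :+ (con 1 :+ k)) refl d k t))
              (cong (λ c → c * ((d + t + c) * (d + t))) c≡t+r)
  rhs : suc k * (d + 2 * t) * (d + k + 1) ≡ (t + r) * ((d + t + (t + r)) * (d + t)) + (t + r) * r * t
  rhs = trans (cong (suc k * (d + 2 * t) *_) (solve 2 (λ d k → d :+ k :+ con 1 := d :+ (con 1 :+ k)) refl d k))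
        (trans (cong (λ c → c * (d + 2 * t) * (d + c)) c≡t+r)
          (solve 3 (λ d t r → (t :+ r) :* (d :+ con 2 :* t) :* (d :+ (t :+ r))
                              := (t :+ r) :* ((d :+ t :+ (t :+ r)) :* (d :+ t)) :+ (t :+ r) :* r :* t) refl d t r))

f≥-[2k+2∸d]/[2k+2] : ∀ k d → f≥ k d (2 * k + 2 ∸ d) (2 * k + 2)
f≥-[2k+2∸d]/[2k+2] k d n _ G avg = begin
  (K ∸ d) * n                 ≡⟨ *-distribʳ-∸ n K d ⟩
  K * n ∸ d * n               ≤⟨ ∸-monoˡ-≤ (d * n) (≤-trans bound (+-monoʳ-≤ (K * α k G) avg)) ⟩
  K * α k G + d * n ∸ d * n   ≡⟨ m+n∸n≡m (K * α k G) (d * n) ⟩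
  K * α k G                   ∎
  where
  open ≤-Reasoning
  K = 2 * k + 2
  bound : K * n ≤ K * α k G + degSum G
  bound = subst₂ (λ x y → x * n ≤ y * α k G + degSum G)
            (solve 1 (λ k → con 2 :* con 1 :* (con 1 :+ k) := con 2 :* k :+ con 2) refl k)
            (solve 1 (λ k → con 1 :* con 2 :* (con 1 :+ k) := con 2 :* k :+ con 2) refl k)
            (degSum-bound G k 1)

⌈/⌉*-≥ : ∀ a n .{{_ : NonZero n}} → a ≤ ⌈ a / n ⌉ * n
⌈/⌉*-≥ a (suc n) = +-cancelʳ-≤ n a _ (begin
  a + n                             ≡⟨ m≡m%n+[m/n]*n (a + n) (suc n) ⟩
  (a + n) % suc n + q * suc n       ≤⟨ +-monoˡ-≤ (q * suc n) (≤-pred (m%n<n (a + n) (suc n))) ⟩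
  n + q * suc n                     ≡⟨ +-comm n (q * suc n) ⟩
  q * suc n + n                     ∎)
  where
  open ≤-Reasoning
  q = (a + n) / suc n

α-⌈avgDeg⌉-bound : ∀ k n .{{_ : NonZero n}} (G : Graph n) → suc k * n ≤ α k G * (⌈avgDeg⌉ G + k + 1)
α-⌈avgDeg⌉-bound k n G = *-cancelˡ-≤ q {{>-nonZero q>0}} (begin
  q * (c * n)               ≡⟨ solve 3 (λ q c n → q :* (c :* n) := c :* q :* n) refl q c n ⟩
  c * q * n                 ≤⟨ *-monoˡ-≤ n (residue-bound≥[k+1]/[d+k+1] k d t t≤c) ⟩
  p * (d + k + 1) * n       ≡⟨ solve 3 (λ p e n → p :* e :* n := e :* (p :* n)) refl p (d + k + 1) n ⟩
  (d + k + 1) * (p * n)     ≤⟨ *-monoʳ-≤ (d + k + 1) (f≥-residue k d t t≤c d≡-t n (>-nonZero⁻¹ n) G (⌈/⌉*-≥ (degSum G) n)) ⟩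
  (d + k + 1) * (q * α k G) ≡⟨ solve 3 (λ e q a → e :* (q :* a) := q :* (a :* e)) refl (d + k + 1) q (α k G) ⟩
  q * (α k G * (d + k + 1)) ∎)
  where
  open ≤-Reasoning
  c = suc k
  d = ⌈avgDeg⌉ G
  t = c ∸ d % c
  p = c * (d + 2 * t)
  q = (d + k + t + 1) * (d + t)
  t≤c : t ≤ c
  t≤c = m∸n≤m c (d % c)
  d≡-t : d % c ≡ (c ∸ t) % c
  d≡-t = sym (trans (cong (_% c) (m∸[m∸n]≡n (<⇒≤ (m%n<n d c)))) (m%n%n≡m%n d c))
  q>0 : 0 < q
  q>0 = *-mono-≤ {1} {d + k + t + 1} {1} {d + t} (m≤n+m 1 _) (≤-trans (m<n⇒0<n∸m (m%n<n d c)) (m≤n+m t d))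

module _ (k : ℕ) where

  private
    N′ = k + suc k
    E = starEdge k

  starGraph-avgDeg≤1 : AvgDeg≤ (starGraph k) 1
  starGraph-avgDeg≤1 = begin
    degSum (starGraph k)
      ≡⟨ trans (sum-allFin (deg (starGraph k))) (sum-cong-≗ λ v → sum-allFin (λ u → 𝟙 (adj (starGraph k) v u))) ⟩
    ∑[ v < suc N′ ] ∑[ u < suc N′ ] 𝟙 (E (toℕ v) (toℕ u) ∨ E (toℕ u) (toℕ v))
      ≤⟨ ∑-mono-≤ {f = λ v → ∑[ u < suc N′ ] 𝟙 (E (toℕ v) (toℕ u) ∨ E (toℕ u) (toℕ v))}
                  {g = λ v → ∑[ u < suc N′ ] (out v u + out u v)}
                  (λ v → ∑-mono-≤ {suc N′} λ u → 𝟙-∨ (E (toℕ v) (toℕ u)) (E (toℕ u) (toℕ v))) ⟩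
    ∑[ v < suc N′ ] ∑[ u < suc N′ ] (out v u + out u v)
      ≡⟨ trans (sum-cong-≗ λ v → ∑-distrib-+ (out v) (λ u → out u v))
               (∑-distrib-+ (λ v → ∑[ u < suc N′ ] out v u) (λ v → ∑[ u < suc N′ ] out u v)) ⟩
    edges + ∑[ v < suc N′ ] ∑[ u < suc N′ ] out u v
      ≡⟨ cong (edges +_) (∑-comm (λ v u → out u v)) ⟩
    edges + edges
      ≤⟨ +-mono-≤ edges≤ edges≤ ⟩
    suc k + suc k
      ≡⟨ *-identityˡ (suc k + suc k) ⟨
    1 * (suc k + suc k) ∎
    where
    open ≤-Reasoning
    out : Fin (suc N′) → Fin (suc N′) → ℕ
    out v u = 𝟙 (E (toℕ v) (toℕ u))
    edges = ∑[ v < suc N′ ] ∑[ u < suc N′ ] out v u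
    -- starEdge only joins the centre 0 to 1, …, k+1
    edges≤ : edges ≤ suc k
    edges≤ = begin
      ∑[ u < N′ ] 𝟙 (toℕ u <ᵇ suc k) + ∑[ v < N′ ] ∑[ u < suc N′ ] 0
        ≡⟨ cong (∑[ u < N′ ] 𝟙 (toℕ u <ᵇ suc k) +_)
                (trans (sum-cong-≗ {N′} λ _ → sum-replicate-zero (suc N′)) (sum-replicate-zero N′)) ⟩
      ∑[ u < N′ ] 𝟙 (toℕ u <ᵇ suc k) + 0
        ≡⟨ +-identityʳ _ ⟩
      ∑[ u < N′ ] 𝟙 (toℕ u <ᵇ suc k)
        ≤⟨ ∑-<ᵇ-≤ N′ (suc k) ⟩
      suc k ∎

  α-starGraph : α k (starGraph k) ≡ 2 * k + 1
  α-starGraph = ≤-antisym (α≤ (starGraph k) kIndep⇒∣p∣≤)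
                          (subst (_≤ α k (starGraph k)) size-nonCentre (size≤α Δ-nonCentre))
    where
    2k+1≡N′ : 2 * k + 1 ≡ N′
    2k+1≡N′ = solve 1 (λ k → con 2 :* k :+ con 1 := k :+ (con 1 :+ k)) refl k

    nonCentre : Fin (suc N′) → Bool
    nonCentre zero    = false
    nonCentre (suc _) = true

    open Induced (starGraph k) using (Δ[_]≤_; size; size≤α)

    -- a non-centre vertex is adjacent at most to the centre, which is not in the set
    Δ-nonCentre : Δ[ nonCentre ]≤ k
    Δ-nonCentre (suc v) _ = subst (_≤ k) (sym (sum-replicate-zero N′)) z≤n

    size-nonCentre : size nonCentre ≡ 2 * k + 1
    size-nonCentre = trans (∑-const-1 N′) (sym 2k+1≡N′)

    kIndep⇒∣p∣≤ : ∀ p → KIndep k (starGraph k) p → ∣ p ∣ ≤ 2 * k + 1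
    kIndep⇒∣p∣≤ (false ∷ p) _ = subst (∣ p ∣ ≤_) (sym 2k+1≡N′) (∣p∣≤n p)
    -- with the centre in p, at most k of the leaves 1, …, k+1 are in p
    kIndep⇒∣p∣≤ (true ∷ p) p-indep = begin
      suc ∣ p ∣                                        ≤⟨ s≤s (∣p∣≤m∸M+∣p∩<M∣ p (suc k)) ⟩
      suc (N′ ∸ suc k + ∑[ i < N′ ] 𝟙 ((toℕ i <ᵇ suc k) ∧ lookup p i))
        ≤⟨ s≤s (+-mono-≤ (≤-reflexive (m+n∸n≡m k (suc k))) centre-deg≤k) ⟩
      suc (k + k)                                      ≡⟨ solve 1 (λ k → con 1 :+ (k :+ k) := con 2 :* k :+ con 1) refl k ⟩
      2 * k + 1                                        ∎
      where
      open ≤-Reasoning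
      centre-deg≤k : ∑[ i < N′ ] 𝟙 ((toℕ i <ᵇ suc k) ∧ lookup p i) ≤ k
      centre-deg≤k = subst (_≤ k)
        (trans (sum-allFin (λ u → 𝟙 (adj (starGraph k) zero u ∧ lookup (true ∷ p) u)))
               (sum-cong-≗ λ i → cong (λ b → 𝟙 (b ∧ lookup p i)) (∨-identityʳ (toℕ i <ᵇ suc k))))
        (p-indep zero Vec.here)

theorem18 :
    ((k d : ℕ) → (t : ℕ) → 1 ≤ t → t ≤ suc k → d % suc k ≡ (suc k ∸ t) % suc k →
        f≥ k d ((suc k) * (d + 2 * t)) ((d + k + t + 1) * (d + t))
      × ((suc k) * ((d + k + t + 1) * (d + t)) ≤ ((suc k) * (d + 2 * t)) * (d + k + 1)))
    × ((k d : ℕ) → d ≤ k → f≥ k d (2 * k + 2 ∸ d) (2 * k + 2))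
    × ((k : ℕ) → 1 ≤ k →
        AvgDeg≤ (starGraph k) 1
      × α k (starGraph k) ≡ 2 * k + 1
      × f≥ k 1 (2 * k + 1) (2 * k + 2))
    × ((k n : ℕ) → .{{_ : NonZero n}} → (G : Graph n) →
        (suc k) * n ≤ α k G * (⌈avgDeg⌉ G + k + 1))
theorem18 =
    (λ k d t _ t≤c d≡-t → f≥-residue k d t t≤c d≡-t , residue-bound≥[k+1]/[d+k+1] k d t t≤c)
  , (λ k d _ → f≥-[2k+2∸d]/[2k+2] k d)
  , (λ k _ → starGraph-avgDeg≤1 k , α-starGraph k ,
       subst (λ p → f≥ k 1 p (2 * k + 2)) (+-∸-assoc (2 * k) {2} {1} (s≤s z≤n)) (f≥-[2k+2∸d]/[2k+2] k 1))
  , α-⌈avgDeg⌉-bound
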